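{- Let $n \ge 2$, let $p_n < p_{n+1}$ be consecutive primes, and let $m = (p_n+p_{n+1})/2$. Let $\alpha p_n$ be the largest odd multiple of $p_n$ not exceeding $m^2$ and $\beta p_{n+1}$ the largest odd multiple of $p_{n+1}$ not exceeding $m^2$. Then $\beta p_{n+1} - \alpha p_n < 2p_n$.
   Context: $p_n$ denotes the $n$-th prime; for $n\ge2$ both $p_n,p_{n+1}$ are odd so $m$ is an integer. -}

module Defs where

open import Data.Nat using (ℕ; _+_; _*_; _≤_; _<_)
open import Data.Nat.Primality using (Prime)
open import Data.Product using (Σ; _×_)
open import Relation.Binary.PropositionalEquality using (_≡_)
open import Relation.Nullary using (¬_)

Odd : ℕ → Set
Odd k = Σ ℕ (λ j → k ≡ 1 + 2 * j)

ConsecutivePrimes : ℕ → ℕ → Set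
ConsecutivePrimes p q =
  Prime p × Prime q × p < q × (∀ r → p < r → r < q → ¬ Prime r)

IsLargestOddMultiple : ℕ → ℕ → ℕ → Set
IsLargestOddMultiple p N k =
  Odd k × k * p ≤ N × (∀ j → Odd j → j * p ≤ N → j ≤ k)

module Submission where

open import Defs
open import Data.Nat using (ℕ; _+_; _*_; _≤_; _<_; _/_; suc)
open import Data.Nat.Properties
  using (≤-<-trans; ≰⇒>; <⇒≱; n<1+n; m≤n⇒m≤1+n; *-distribʳ-+; +-comm; +-suc; _≤?_)
open import Data.Empty using (⊥-elim)
open import Data.Product using (_,_)
open import Relation.Binary.PropositionalEquality using (_≡_; cong; subst; sym; trans)
open import Relation.Nullary using (yes; no)

-- Since α is maximal, the next odd multiple (α + 2) p already exceeds m², while β q ≤ m².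

Odd-2+ : ∀ {k} → Odd k → Odd (2 + k)
Odd-2+ {k} (j , k≡1+2j) = suc j , trans (cong (2 +_) k≡1+2j) (cong suc (sym (+-suc (suc j) (j + 0))))

IsLargestOddMultiple⇒bound : ∀ {p N k} → IsLargestOddMultiple p N k → N < k * p + 2 * p
IsLargestOddMultiple⇒bound {p} {N} {k} (odd-k , _ , maximal) with (2 + k) * p ≤? N
... | yes [2+k]*p≤N = ⊥-elim (<⇒≱ (m≤n⇒m≤1+n (n<1+n k)) (maximal (2 + k) (Odd-2+ odd-k) [2+k]*p≤N))
... | no [2+k]*p≰N = subst (N <_) [2+k]*p≡k*p+2*p (≰⇒> [2+k]*p≰N)
  where
  [2+k]*p≡k*p+2*p : (2 + k) * p ≡ k * p + 2 * p
  [2+k]*p≡k*p+2*p = trans (*-distribʳ-+ p 2 k) (+-comm (2 * p) (k * p))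

corollary2p2p1 : (p q : ℕ) → 3 ≤ p → ConsecutivePrimes p q →
    (α β : ℕ) →
    IsLargestOddMultiple p (((p + q) / 2) * ((p + q) / 2)) α →
    IsLargestOddMultiple q (((p + q) / 2) * ((p + q) / 2)) β →
    β * q < α * p + 2 * p
corollary2p2p1 p q _ _ α β largest-α (_ , βq≤m² , _) =
  ≤-<-trans βq≤m² (IsLargestOddMultiple⇒bound largest-α)
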